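{- Let $F_1,\dots,F_n$ be pairwise edge-disjoint matchings, each of size $n$, in a graph. Let $R$ be a rainbow matching of maximum possible size $q$, with a fixed injection $\phi:R\to[n]$ satisfying $e\in F_{\phi(e)}$ for all $e\in R$, and let $J=[n]\setminus\phi(R)$. For $j\in J$, call a pair $\{e,f\}$ of distinct edges of $R$ half-$j$-wasteful if $F_j$ contains edges $g_e,g_f,g_{ef}$ such that $g_e$ intersects $e$ and no other edge of $R$, $g_f$ intersects $f$ and no other edge of $R$, and $g_{ef}$ intersects both $e$ and $f$. For $e\in R$ let $HW(e)$ be the set of $j\in J$ for which there is $f\in R$ with $\{e,f\}$ half-$j$-wasteful, and let $E_e$ be the set of edges $g\in\bigcup_{j\in HW(e)}F_j$ that intersect $e$ and no other edge of $R$. If $e\in R$ satisfies $|HW(e)|\ge 3$, then all edges in $E_e$ intersect $e$ at the same vertex, i.e. $e\cap\bigcap E_e\neq\emptyset$.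
   Context: A rainbow matching is a matching $M$ together with an injection $\psi:M\to[n]$ with $x\in F_{\psi(x)}$ for every $x\in M$; "maximum possible size" is over all rainbow matchings. -}

module Defs where

open import Data.Nat using (ℕ; _<_; _≤_)
open import Data.Fin using (Fin)
open import Data.Product using (_×_; _,_; proj₁; proj₂; ∃; Σ-syntax)
open import Data.Sum using (_⊎_)
open import Data.List using (List; length; map)
open import Data.List.Membership.Propositional using (_∈_)
open import Data.List.Relation.Unary.All using (All)
open import Data.List.Relation.Unary.AllPairs using (AllPairs)
open import Relation.Binary.PropositionalEquality using (_≡_; _≢_)
open import Relation.Nullary using (¬_)
open import Data.Empty using (⊥)

-- Vertices are natural numbers.  An edge of a (simple) graph is a
-- 2-element vertex set {a , b}, represented canonically as (a , b) with a < b.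
Edge : Set
Edge = ℕ × ℕ

ValidEdge : Edge → Set
ValidEdge (a , b) = a < b

_∈ᵥ_ : ℕ → Edge → Set
v ∈ᵥ (a , b) = (v ≡ a) ⊎ (v ≡ b)

Intersects : Edge → Edge → Set
Intersects e f = ∃ λ v → (v ∈ᵥ e) × (v ∈ᵥ f)

-- a matching: a list of valid edges, any two (at distinct positions) disjoint
-- (so in particular all listed edges are distinct; its size is its length)
IsMatching : List Edge → Set
IsMatching M = All ValidEdge M × AllPairs (λ e f → ¬ Intersects e f) M

MatchingsOfSizeN : (n : ℕ) → (Fin n → List Edge) → Set
MatchingsOfSizeN n F = ∀ i → IsMatching (F i) × (length (F i) ≡ n)

PairwiseEdgeDisjoint : (n : ℕ) → (Fin n → List Edge) → Set
PairwiseEdgeDisjoint n F = ∀ i j e → i ≢ j → e ∈ F i → e ∈ F j → ⊥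

-- A rainbow matching together with its injection ψ : M → [n] is represented
-- as a list of pairs (x , ψ x): the edges form a matching, the colours are
-- pairwise distinct (ψ injective) and x ∈ F (ψ x).
IsRainbow : (n : ℕ) → (Fin n → List Edge) → List (Edge × Fin n) → Set
IsRainbow n F R =
  IsMatching (map proj₁ R) × AllPairs _≢_ (map proj₂ R)
  × All (λ p → proj₁ p ∈ F (proj₂ p)) R

IsMaxRainbow : (n : ℕ) → (Fin n → List Edge) → List (Edge × Fin n) → Set
IsMaxRainbow n F R =
  IsRainbow n F R × (∀ R′ → IsRainbow n F R′ → length R′ ≤ length R)

module _ {n : ℕ} (F : Fin n → List Edge) (R : List (Edge × Fin n)) where

  InJ : Fin n → Set
  InJ j = ¬ (j ∈ map proj₂ R)

  MeetsOnly : Edge → Edge → Set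
  MeetsOnly e g = Intersects g e
    × (∀ f → f ∈ map proj₁ R → f ≢ e → ¬ Intersects g f)

  HalfWasteful : Fin n → Edge → Edge → Set
  HalfWasteful j e f =
    e ∈ map proj₁ R × f ∈ map proj₁ R × e ≢ f
    × (∃ λ gₑ → gₑ ∈ F j × MeetsOnly e gₑ)
    × (∃ λ g_f → g_f ∈ F j × MeetsOnly f g_f)
    × (∃ λ gₑ_f → gₑ_f ∈ F j × Intersects gₑ_f e × Intersects gₑ_f f)

  InHW : Edge → Fin n → Set
  InHW e j = InJ j × (∃ λ f → HalfWasteful j e f)

  InE : Edge → Edge → Set
  InE e g = (∃ λ j → InHW e j × g ∈ F j) × MeetsOnly e g

-- Let x be the vertex of e met by a pendant edge (one meeting e and no other
-- edge of R) of some colour in HW(e), and suppose a pendant g of a colour in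
-- HW(e) meets e at its other vertex y. Two pendants of distinct free colours
-- must intersect, since otherwise they could replace e in R; a pendant of a
-- free colour cannot contain e itself, as F is edge-disjoint. If the colours
-- agree, the edge g_ef of that colour meets e at x or at y and so coincides
-- with one of the two pendants, which then meets f as well. If they differ,
-- the two pendants share a vertex z off e, and a pendant h of a third colour of
-- HW(e) meets e at x (say) and must meet the pendant through y, hence at z;
-- then h and the pendant through x share the two vertices x and z, so they are
-- the same edge in two different colour classes.
module Submission where

open import Defs
open import Data.Nat using (ℕ; suc; _≤_; _≟_)
open import Data.Nat.Properties using (<-asym; 1+n≰n)
open import Data.Fin using (Fin)
import Data.Fin as Fin
open import Data.Product using (_×_; _,_; proj₁; proj₂; ∃)
open import Data.Sum using (_⊎_; inj₁; inj₂)
open import Data.List using (List; _∷_; map; length)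
open import Data.List.Properties using (length-removeAt′)
open import Data.List.Relation.Unary.Any using (here; there; _─_; index)
open import Data.List.Membership.Propositional using (_∈_)
open import Data.List.Membership.Propositional.Properties using (∈-map⁺; ∈-map⁻; ∈-AllPairs₂)
open import Data.List.Relation.Unary.All as All using (All; _∷_)
import Data.List.Relation.Unary.All.Properties as All
open import Data.List.Relation.Unary.AllPairs as AllPairs using (AllPairs; _∷_)
import Data.List.Relation.Unary.AllPairs.Properties as AllPairs
open import Data.Empty using (⊥; ⊥-elim)
open import Function using (_∘_)
open import Relation.Binary.Definitions using (DecidableEquality; Symmetric)
open import Relation.Binary.PropositionalEquality using (_≡_; _≢_; refl; sym; subst)
open import Relation.Nullary using (¬_; Dec; yes; no)

private
  variable
    A : Set
    x y z t : ℕ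
    f g h : Edge

Intersects-refl : ∀ e → Intersects e e
Intersects-refl (a , _) = a , inj₁ refl , inj₁ refl

Intersects-sym : Intersects g h → Intersects h g
Intersects-sym (v , v∈g , v∈h) = v , v∈h , v∈g

Intersects? : ∀ g h → Dec (Intersects g h)
Intersects? (a , b) (c , d) with a ≟ c | a ≟ d | b ≟ c | b ≟ d
... | yes a≡c | _       | _       | _       = yes (a , inj₁ refl , inj₁ a≡c)
... | _       | yes a≡d | _       | _       = yes (a , inj₁ refl , inj₂ a≡d)
... | _       | _       | yes b≡c | _       = yes (b , inj₂ refl , inj₁ b≡c)
... | _       | _       | _       | yes b≡d = yes (b , inj₂ refl , inj₂ b≡d)
... | no a≢c  | no a≢d  | no b≢c  | no b≢d  = no λ
  { (_ , inj₁ refl , inj₁ refl) → a≢c refl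
  ; (_ , inj₁ refl , inj₂ refl) → a≢d refl
  ; (_ , inj₂ refl , inj₁ refl) → b≢c refl
  ; (_ , inj₂ refl , inj₂ refl) → b≢d refl }

∈ᵥ-either : x ≢ y → x ∈ᵥ g → y ∈ᵥ g → t ∈ᵥ g → t ≡ x ⊎ t ≡ y
∈ᵥ-either x≢y (inj₁ refl) (inj₁ refl) _ = ⊥-elim (x≢y refl)
∈ᵥ-either x≢y (inj₂ refl) (inj₂ refl) _ = ⊥-elim (x≢y refl)
∈ᵥ-either _ (inj₁ refl) (inj₂ refl) (inj₁ refl) = inj₁ refl
∈ᵥ-either _ (inj₁ refl) (inj₂ refl) (inj₂ refl) = inj₂ refl
∈ᵥ-either _ (inj₂ refl) (inj₁ refl) (inj₁ refl) = inj₂ refl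
∈ᵥ-either _ (inj₂ refl) (inj₁ refl) (inj₂ refl) = inj₁ refl

-- The orientation a < b of a valid edge is what rules out (a , b) ≡ (b , a).
two-common-vertices⇒≡ : ValidEdge g → ValidEdge h → x ≢ y
  → x ∈ᵥ g → y ∈ᵥ g → x ∈ᵥ h → y ∈ᵥ h → g ≡ h
two-common-vertices⇒≡ _ _ x≢y (inj₁ refl) (inj₁ refl) _ _ = ⊥-elim (x≢y refl)
two-common-vertices⇒≡ _ _ x≢y (inj₂ refl) (inj₂ refl) _ _ = ⊥-elim (x≢y refl)
two-common-vertices⇒≡ _ _ x≢y _ _ (inj₁ refl) (inj₁ refl) = ⊥-elim (x≢y refl)
two-common-vertices⇒≡ _ _ x≢y _ _ (inj₂ refl) (inj₂ refl) = ⊥-elim (x≢y refl)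
two-common-vertices⇒≡ _ _ _ (inj₁ refl) (inj₂ refl) (inj₁ refl) (inj₂ refl) = refl
two-common-vertices⇒≡ _ _ _ (inj₂ refl) (inj₁ refl) (inj₂ refl) (inj₁ refl) = refl
two-common-vertices⇒≡ vg vh _ (inj₁ refl) (inj₂ refl) (inj₂ refl) (inj₁ refl) = ⊥-elim (<-asym vg vh)
two-common-vertices⇒≡ vg vh _ (inj₂ refl) (inj₁ refl) (inj₁ refl) (inj₂ refl) = ⊥-elim (<-asym vg vh)

matching-intersecting⇒≡ : ∀ {M} → IsMatching M → g ∈ M → h ∈ M → Intersects g h → g ≡ h
matching-intersecting⇒≡ (_ , disjoint) g∈M h∈M g∩h with ∈-AllPairs₂ disjoint g∈M h∈M
... | inj₁ g≡h = g≡h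
... | inj₂ (inj₁ ¬g∩h) = ⊥-elim (¬g∩h g∩h)
... | inj₂ (inj₂ ¬h∩g) = ⊥-elim (¬h∩g (Intersects-sym g∩h))

avoid-two : {P : A → Set} → DecidableEquality A → ∀ {j₁ j₂ j₃}
  → j₁ ≢ j₂ → j₁ ≢ j₃ → j₂ ≢ j₃ → P j₁ → P j₂ → P j₃
  → ∀ a b → ∃ λ c → c ≢ a × c ≢ b × P c
avoid-two _≟_ {j₁} {j₂} d₁₂ d₁₃ d₂₃ p₁ p₂ p₃ a b with j₁ ≟ a | j₁ ≟ b | j₂ ≟ a | j₂ ≟ b
... | no 1≢a | no 1≢b | _ | _ = _ , 1≢a , 1≢b , p₁
... | _ | _ | no 2≢a | no 2≢b = _ , 2≢a , 2≢b , p₂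
... | yes refl | _ | _ | yes refl = _ , d₁₃ ∘ sym , d₂₃ ∘ sym , p₃
... | _ | yes refl | yes refl | _ = _ , d₂₃ ∘ sym , d₁₃ ∘ sym , p₃
... | yes refl | _ | yes refl | _ = ⊥-elim (d₁₂ refl)
... | _ | yes refl | _ | yes refl = ⊥-elim (d₁₂ refl)

AllPairs-─⁺ : ∀ {S : A → A → Set} {xs} {u : A} (p : u ∈ xs) → AllPairs S xs → AllPairs S (xs ─ p)
AllPairs-─⁺ (here _) (_ ∷ rest) = rest
AllPairs-─⁺ (there p) (first ∷ rest) = All.─⁺ p first ∷ AllPairs-─⁺ p rest

AllPairs-─-related : ∀ {S : A → A → Set} → Symmetric S → ∀ {xs} {u : A} (p : u ∈ xs)
  → AllPairs S xs → All (S u) (xs ─ p)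
AllPairs-─-related _ (here refl) (first ∷ _) = first
AllPairs-─-related S-sym (there p) (first ∷ rest) =
  S-sym (All.lookup first p) ∷ AllPairs-─-related S-sym p rest

module _ {n : ℕ} {F : Fin n → List Edge} where

  private
    variable
      a b c j : Fin n
      R : List (Edge × Fin n)

  free-colour-unused : InJ F R a → All (λ q → a ≢ proj₂ q) R
  free-colour-unused a∉ = All.tabulate λ { q∈R refl → a∉ (∈-map⁺ proj₂ q∈R) }

  exchange : ∀ {u} → IsRainbow n F R → (p : u ∈ R)
    → ValidEdge g → ValidEdge h → g ∈ F a → h ∈ F b → a ≢ b → InJ F R a → InJ F R b
    → ¬ Intersects g h
    → All (λ q → ¬ Intersects g (proj₁ q)) (R ─ p)
    → All (λ q → ¬ Intersects h (proj₁ q)) (R ─ p)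
    → IsRainbow n F ((g , a) ∷ (h , b) ∷ (R ─ p))
  exchange ((valid-edges , disjoint) , distinct , inF) p vg vh g∈ h∈ a≢b a∉ b∉ ¬g∩h g∩R h∩R =
    ( (vg ∷ vh ∷ All.map⁺ (All.─⁺ p (All.map⁻ valid-edges)))
    , (¬g∩h ∷ All.map⁺ g∩R) ∷ All.map⁺ h∩R
        ∷ AllPairs.map⁺ (AllPairs-─⁺ p (AllPairs.map⁻ disjoint)) )
    , (a≢b ∷ All.map⁺ (All.─⁺ p (free-colour-unused a∉)))
        ∷ All.map⁺ (All.─⁺ p (free-colour-unused b∉))
        ∷ AllPairs.map⁺ (AllPairs-─⁺ p (AllPairs.map⁻ distinct))
    , g∈ ∷ h∈ ∷ All.─⁺ p inF

  module _ (matchings : MatchingsOfSizeN n F) (edge-disjoint : PairwiseEdgeDisjoint n F) where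

    valid : g ∈ F a → ValidEdge g
    valid {a = a} g∈ = All.lookup (proj₁ (proj₁ (matchings a))) g∈

    common-vertex-unique : g ∈ F a → h ∈ F b → a ≢ b
      → x ∈ᵥ g → y ∈ᵥ g → x ∈ᵥ h → y ∈ᵥ h → x ≡ y
    common-vertex-unique {a = a} {b = b} {x = x} {y = y} g∈ h∈ a≢b x∈g y∈g x∈h y∈h with x ≟ y
    ... | yes x≡y = x≡y
    ... | no x≢y = ⊥-elim (edge-disjoint a b _ a≢b g∈
          (subst (_∈ F b) (sym (two-common-vertices⇒≡ (valid g∈) (valid h∈) x≢y x∈g y∈g x∈h y∈h)) h∈))

    module _ {R} (maximum : IsMaxRainbow n F R) {e c₀} (e∈R : (e , c₀) ∈ R) where

      free-edge-meets-e-once : h ∈ F c → InJ F R c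
        → x ∈ᵥ h → y ∈ᵥ h → x ∈ᵥ e → y ∈ᵥ e → x ≡ y
      free-edge-meets-e-once h∈ c∉ =
        common-vertex-unique h∈ (All.lookup (proj₂ (proj₂ (proj₁ maximum))) e∈R)
          (λ { refl → c∉ (∈-map⁺ proj₂ e∈R) })

      record Pendant (j : Fin n) (v : ℕ) : Set where
        field
          edge : Edge
          ∈F : edge ∈ F j
          free : InJ F R j
          meetsOnly : MeetsOnly F R e edge
          v∈edge : v ∈ᵥ edge
          v∈e : v ∈ᵥ e
      open Pendant

      HW-pendant : InHW F R e j → ∃ (Pendant j)
      HW-pendant (j∉ , _ , _ , _ , _ , (g , g∈ , only@((v , v∈g , v∈e) , _)) , _) =
        v , record { edge = g ; ∈F = g∈ ; free = j∉ ; meetsOnly = only ; v∈edge = v∈g ; v∈e = v∈e }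

      pendant-avoids-other-end : (p : Pendant a x) → y ∈ᵥ e → x ≢ y → ¬ y ∈ᵥ edge p
      pendant-avoids-other-end p y∈e x≢y y∈p =
        x≢y (free-edge-meets-e-once (∈F p) (free p) (v∈edge p) y∈p (v∈e p) y∈e)

      MeetsOnly-avoids-rest : MeetsOnly F R e g → All (λ q → ¬ Intersects g (proj₁ q)) (R ─ e∈R)
      MeetsOnly-avoids-rest (_ , only) =
        All.zipWith (λ (q∈R , ¬e∩q) → only _ (∈-map⁺ proj₁ q∈R)
                      (λ q≡e → ¬e∩q (subst (Intersects e) (sym q≡e) (Intersects-refl e))))
          ( All.─⁺ e∈R (All.tabulate (λ q∈R → q∈R))
          , AllPairs-─-related (λ ¬u∩v v∩u → ¬u∩v (Intersects-sym v∩u)) e∈R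
              (AllPairs.map⁻ (proj₂ (proj₁ (proj₁ maximum)))) )

      no-rainbow-exchange : ∀ {u v} → ¬ IsRainbow n F (u ∷ v ∷ (R ─ e∈R))
      no-rainbow-exchange rainbow =
        1+n≰n (subst (suc (suc (length (R ─ e∈R))) ≤_) (length-removeAt′ R (index e∈R))
                     (proj₂ maximum _ rainbow))

      pendants-intersect : (p : Pendant a x) (p′ : Pendant b y) → a ≢ b → Intersects (edge p) (edge p′)
      pendants-intersect p p′ a≢b with Intersects? (edge p) (edge p′)
      ... | yes p∩p′ = p∩p′
      ... | no ¬p∩p′ = ⊥-elim (no-rainbow-exchange
            (exchange (proj₁ maximum) e∈R (valid (∈F p)) (valid (∈F p′)) (∈F p) (∈F p′) a≢b
                      (free p) (free p′) ¬p∩p′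
                      (MeetsOnly-avoids-rest (meetsOnly p)) (MeetsOnly-avoids-rest (meetsOnly p′))))

      crossing-avoids-pendant : (p : Pendant a x) → h ∈ F a
        → f ∈ map proj₁ R → f ≢ e → Intersects h f → ¬ x ∈ᵥ h
      crossing-avoids-pendant {a = a} {f = f} p h∈ f∈R f≢e h∩f x∈h =
        proj₂ (meetsOnly p) f f∈R f≢e
          (subst (λ k → Intersects k f)
                 (matching-intersecting⇒≡ (proj₁ (matchings a)) h∈ (∈F p) (_ , x∈h , v∈edge p)) h∩f)

      -- The edge g_ef of colour a meets e, at x or at y.
      HW-pendants-not-apart : InHW F R e a → Pendant a x → Pendant a y → x ≢ y → ⊥
      HW-pendants-not-apart (_ , _ , (_ , f∈R , e≢f , _ , _ , (k , k∈ , (w , w∈k , w∈e) , k∩f))) p p′ x≢y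
        with ∈ᵥ-either x≢y (v∈e p) (v∈e p′) w∈e
      ... | inj₁ refl = crossing-avoids-pendant p k∈ f∈R (e≢f ∘ sym) k∩f w∈k
      ... | inj₂ refl = crossing-avoids-pendant p′ k∈ f∈R (e≢f ∘ sym) k∩f w∈k

      third-pendant-impossible : (h : Pendant c x) (g : Pendant a x) (g′ : Pendant b y)
        → c ≢ a → c ≢ b → x ≢ y → z ∈ᵥ edge g → z ∈ᵥ edge g′ → ⊥
      third-pendant-impossible h g g′ c≢a c≢b x≢y z∈g z∈g′
        with pendants-intersect h g′ c≢b
      ... | t , t∈h , t∈g′
        with ∈ᵥ-either (λ y≡z → pendant-avoids-other-end g (v∈e g′) x≢y (subst (_∈ᵥ edge g) (sym y≡z) z∈g))
                       (v∈edge g′) z∈g′ t∈g′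
      ... | inj₁ refl = pendant-avoids-other-end h (v∈e g′) x≢y t∈h
      ... | inj₂ refl = pendant-avoids-other-end g′ (v∈e g) (x≢y ∘ sym)
            (subst (_∈ᵥ edge g′)
                   (sym (common-vertex-unique (∈F h) (∈F g) c≢a (v∈edge h) t∈h (v∈edge g) z∈g)) z∈g′)

      HW-pendants-meet-e-together : (∀ a b → ∃ λ c → c ≢ a × c ≢ b × InHW F R e c)
        → InHW F R e a → InHW F R e b → Pendant a x → Pendant b y → x ≡ y
      HW-pendants-meet-e-together {a = a} {b = b} {x = x} {y = y} third hw-a hw-b g g′ with x ≟ y
      ... | yes x≡y = x≡y
      ... | no x≢y with a Fin.≟ b
      ...   | yes refl = ⊥-elim (HW-pendants-not-apart hw-a g g′ x≢y)
      ...   | no a≢b with pendants-intersect g g′ a≢b | third a b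
      ...     | z , z∈g , z∈g′ | c , c≢a , c≢b , hw-c with HW-pendant hw-c
      ...       | _ , h with ∈ᵥ-either x≢y (v∈e g) (v∈e g′) (v∈e h)
      ...         | inj₁ refl = ⊥-elim (third-pendant-impossible h g g′ c≢a c≢b x≢y z∈g z∈g′)
      ...         | inj₂ refl = ⊥-elim (third-pendant-impossible h g′ g c≢b c≢a (x≢y ∘ sym) z∈g′ z∈g)

      E-edges-share-vertex : (∀ a b → ∃ λ c → c ≢ a × c ≢ b × InHW F R e c)
        → InHW F R e j → ∃ λ v → v ∈ᵥ e × (∀ g → InE F R e g → v ∈ᵥ g)
      E-edges-share-vertex third hw with HW-pendant hw
      ... | x , p = x , v∈e p , through
        where
        through : ∀ g → InE F R e g → x ∈ᵥ g
        through g ((k , hw-k , g∈) , only@((w , w∈g , w∈e) , _)) =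
          subst (_∈ᵥ g) (sym (HW-pendants-meet-e-together third hw hw-k p
            record { edge = g ; ∈F = g∈ ; free = proj₁ hw-k ; meetsOnly = only ; v∈edge = w∈g ; v∈e = w∈e }))
            w∈g

lemma2p7 : (n : ℕ) (F : Fin n → List Edge)
    → MatchingsOfSizeN n F → PairwiseEdgeDisjoint n F
    → (R : List (Edge × Fin n)) → IsMaxRainbow n F R
    → (e : Edge) → e ∈ map proj₁ R
    → (∃ λ j₁ → ∃ λ j₂ → ∃ λ j₃ → j₁ ≢ j₂ × j₁ ≢ j₃ × j₂ ≢ j₃
         × InHW F R e j₁ × InHW F R e j₂ × InHW F R e j₃)
    → ∃ λ v → v ∈ᵥ e × (∀ g → InE F R e g → v ∈ᵥ g)
lemma2p7 n F matchings edge-disjoint R maximum e e∈R (_ , _ , _ , d₁₂ , d₁₃ , d₂₃ , hw₁ , hw₂ , hw₃)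
  with ∈-map⁻ proj₁ e∈R
... | _ , e,c₀∈R , refl =
  E-edges-share-vertex matchings edge-disjoint maximum e,c₀∈R
    (avoid-two Fin._≟_ d₁₂ d₁₃ d₂₃ hw₁ hw₂ hw₃) hw₁
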